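{- Let $S$ be a finite $\Gamma$-colored ordered set and let $(\sigma,v)\preceq(\pi,w)$ in $\mathcal Y(S)$. Write $\pi=(C_1,\ldots,C_q)$, $w=w(1)\cdots w(q)$, and for each $k$ let $v_k$ be the word of colors (in left-to-right order) of those blocks of $\sigma$ that are contained in $C_k$. Then there is a natural order isomorphism $$\theta:[\sigma,\pi]\to Y_{v_1}^{w(1)}\times\cdots\times Y_{v_q}^{w(q)}$$ (product partial order on the right) such that for every $\lambda\in[\sigma,\pi]$, writing $\theta(\lambda)=(\lambda_1,\ldots,\lambda_q)$, the colored ordered set of blocks of $\lambda$ is isomorphic (as a colored ordered set) to the concatenation $\lambda_1\sqcup\cdots\sqcup\lambda_q$ of the colored ordered sets of blocks of the $\lambda_k$.
   Context: Fix a finite set of colors $\Gamma$. A colored ordered set is a finite linearly ordered set $S=(x_1<\cdots<x_p)$ with a map $c:S\to\Gamma$, identified with the word $c(x_1)\cdots c(x_p)\in\Gamma^*$; two such are isomorphic if there is an order isomorphism preserving colors. A colored ordered (interval) partition of $S$ is a pair $(\sigma,c_\sigma)$ where $\sigma=(B_1,\ldots,B_q)$ is a partition of $S$ into nonempty blocks with $B_1<\cdots<B_q$ (each block consists of consecutive elements), and $c_\sigma$ colors the blocks so that each singleton block $\{x\}$ has color $c(x)$; the blocks of $\sigma$ with colors $c_\sigma$ form a colored ordered set. $\mathcal Y(S)$ is the set of all colored ordered partitions of $S$, partially ordered by $(\sigma,v)\preceq(\pi,w)$ iff every block of $\sigma$ is contained in a block of $\pi$ and every block common to $\sigma$ and $\pi$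 has the same color in both. For a word $v\in\Gamma^*$ of length $p$ and $j\in\Gamma$, let $S_v$ be $\{1,\ldots,p\}$ colored by $v$, $\mathbf 0_v\in\mathcal Y(S_v)$ the partition into singletons (colored by $v$), $\mathbf 1_j$ the one-block partition colored $j$, and $Y_v^j=[\mathbf 0_v,\mathbf 1_j]=\{\lambda\in\mathcal Y(S_v):\mathbf 0_v\preceq\lambda\preceq\mathbf 1_j\}$ with the induced order; $[\sigma,\pi]$ denotes the analogous segment in $\mathcal Y(S)$. -}

module Defs where

open import Data.Nat using (ℕ; zero; suc; _+_; _≤_; _≤?_)
open import Data.List using (List; []; _∷_; map; concat; length; filter; lookup; tabulate)
open import Data.List.Relation.Unary.All using (All)
open import Data.List.Membership.Propositional using (_∈_)
open import Data.Product using (Σ; ∃; ∃₂; _×_; _,_; proj₁; proj₂)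
open import Data.Fin using (Fin)
import Data.Fin as F
open import Relation.Binary.PropositionalEquality using (_≡_)
open import Relation.Nullary using (Dec)
open import Relation.Nullary.Decidable using (_×-dec_)

-- A block of a colored ordered partition: the word of colors of its
-- elements (left to right) together with the color of the block.
Block : Set → Set
Block Γ = List Γ × Γ

-- A colored ordered (interval) partition, given by its blocks B₁ < ⋯ < B_q.
CPart : Set → Set
CPart Γ = List (Block Γ)

NonEmpty : {A : Set} → List A → Set
NonEmpty xs = ∃₂ λ x ys → xs ≡ x ∷ ys

SingletonOK : {Γ : Set} → Block Γ → Set
SingletonOK (u , c) = ∀ x → u ≡ x ∷ [] → c ≡ x

-- β is a colored ordered partition of the colored ordered set S
-- (S = {0,…,p-1} with colors given by the word S)
record IsPartOf {Γ : Set} (S : List Γ) (β : CPart Γ) : Set where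
  field
    covers    : concat (map proj₁ β) ≡ S
    nonempty  : All (λ b → NonEmpty (proj₁ b)) β
    singleton : All SingletonOK β

𝒴 : {Γ : Set} → List Γ → Set
𝒴 {Γ} S = Σ (CPart Γ) (IsPartOf S)

-- A block located in S: (first position, number of elements, color).
-- Its underlying set of positions is {start, …, start + len - 1}.
record PBlock (Γ : Set) : Set where
  constructor pb
  field
    start : ℕ
    len   : ℕ
    col   : Γ
open PBlock public

positioned : {Γ : Set} → ℕ → CPart Γ → List (PBlock Γ)
positioned o [] = []
positioned o ((u , c) ∷ β) = pb o (length u) c ∷ positioned (o + length u) β

blocks : {Γ : Set} → CPart Γ → List (PBlock Γ)
blocks = positioned 0

positionedAt : {Γ : Set} → ℕ → (β : CPart Γ) → Fin (length β) → PBlock Γ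
positionedAt o ((u , c) ∷ β) F.zero = pb o (length u) c
positionedAt o ((u , c) ∷ β) (F.suc k) = positionedAt (o + length u) β k

blockAt : {Γ : Set} → (β : CPart Γ) → Fin (length β) → PBlock Γ
blockAt = positionedAt 0

_⊆ᵇ_ : {Γ : Set} → PBlock Γ → PBlock Γ → Set
B ⊆ᵇ C = (start C ≤ start B) × (start B + len B ≤ start C + len C)

_⊆ᵇ?_ : {Γ : Set} → (B C : PBlock Γ) → Dec (B ⊆ᵇ C)
B ⊆ᵇ? C = (start C ≤? start B) ×-dec (start B + len B ≤? start C + len C)

_⪯_ : {Γ : Set} → CPart Γ → CPart Γ → Set
σ ⪯ π =
  (∀ B → B ∈ blocks σ → ∃ λ C → C ∈ blocks π × B ⊆ᵇ C) ×
  (∀ B C → B ∈ blocks σ → C ∈ blocks π →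
     start B ≡ start C → len B ≡ len C → col B ≡ col C)

-- word of colors of the blocks (the colored ordered set of blocks)
blockWord : {Γ : Set} → CPart Γ → List Γ
blockWord β = map proj₂ β

𝟎 : {Γ : Set} → List Γ → CPart Γ
𝟎 v = map (λ x → (x ∷ [] , x)) v

𝟏 : {Γ : Set} → List Γ → Γ → CPart Γ
𝟏 v j = (v , j) ∷ []

record Segment {Γ : Set} (S : List Γ) (σ π : CPart Γ) : Set where
  constructor seg
  field
    elem  : 𝒴 S
    above : σ ⪯ proj₁ elem
    below : proj₁ elem ⪯ π

Y : {Γ : Set} → List Γ → Γ → Set
Y v j = Segment v (𝟎 v) (𝟏 v j)

part : {Γ : Set} {S : List Γ} {σ π : CPart Γ} → Segment S σ π → CPart Γ
part l = proj₁ (Segment.elem l)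

subWord : {Γ : Set} → CPart Γ → (π : CPart Γ) → Fin (length π) → List Γ
subWord σ π k = map col (filter (λ B → B ⊆ᵇ? blockAt π k) (blocks σ))

colAt : {Γ : Set} → (π : CPart Γ) → Fin (length π) → Γ
colAt π k = proj₂ (lookup π k)

-- An element λ of [σ, π] groups the blocks of σ into runs, and since λ ⪯ π no run crosses a block C_k
-- of π. So λ is the concatenation of its pieces λ_k, each a coarsening of the run σ_k of blocks of σ
-- inside C_k lying below the one-block partition (C_k, w(k)). Collapsing every block of σ_k to a single
-- point of its colour turns these coarsenings into those of 𝟎_{v_k} below 𝟏_{w(k)}, i.e. into the
-- elements of Y_{v_k}^{w(k)}, without changing the colours of the blocks; both steps preserve and
-- reflect refinement. Everything is carried out for the relation _⊑_ ("obtained by merging runs of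
-- consecutive blocks"), which on partitions of the same word coincides with the positional order _⪯_.
module Submission where

open import Data.Nat using (ℕ; zero; suc; _+_; _≤_; _<_; z≤n; s≤s)
open import Data.Nat.Properties
  using ( ≤-refl; ≤-trans; ≤-reflexive; <⇒≱; <-≤-trans; <-irrefl; m<m+n; m≤m+n; m+1+n≰m
        ; +-monoʳ-≤; +-assoc; +-identityʳ; +-cancelˡ-≤ )
open import Data.Fin using (Fin)
import Data.Fin as F
open import Data.List using (List; []; _∷_; _++_; map; concat; concatMap; length; tabulate; lookup; filter; [_])
open import Data.List.Properties
  using ( concat-++; concatMap-++; concat-map; concat-map-[_]; map-∘; map-tabulate; tabulate-lookup; tabulate-cong
        ; ++-identityʳ; ++-identityʳ-unique; ++-cancelˡ; ++-conicalˡ; ++-conicalʳ; ++-assoc; ∷-injective; ∷-injectiveˡ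
        ; length-++; filter-++; filter-all; filter-none )
open import Data.List.Relation.Unary.All as All using (All; []; _∷_)
open import Data.List.Relation.Unary.All.Properties using (++⁻ˡ; ++⁻ʳ; concat⁻; tabulate⁻; map⁺)
open import Data.List.Relation.Unary.Any using (here; there)
open import Data.List.Membership.Propositional using (_∈_)
open import Data.List.Membership.Propositional.Properties using (∈-++⁻; ∈-++⁺ʳ)
open import Data.List.Relation.Binary.Pointwise as Pointwise using (Pointwise; []; _∷_)
open import Data.Product using (Σ; ∃; ∃₂; _×_; _,_; proj₁; proj₂)
open import Data.Sum using (_⊎_; inj₁; inj₂)
open import Data.Empty using (⊥-elim)
open import Function using (_∘_)
open import Relation.Nullary using (¬_)
open import Relation.Binary.PropositionalEquality hiding ([_])
open import Defs

private
  variable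
    A B B′ C : Set

++-overlap : (w r w′ r′ : List A) → w ++ r ≡ w′ ++ r′ →
  (∃ λ d → w′ ≡ w ++ d × r ≡ d ++ r′) ⊎ (∃ λ d → w ≡ w′ ++ d × r′ ≡ d ++ r)
++-overlap []      r w′       r′ eq = inj₁ (w′ , refl , eq)
++-overlap (x ∷ w) r []       r′ eq = inj₂ (x ∷ w , refl , sym eq)
++-overlap (x ∷ w) r (y ∷ w′) r′ eq with ∷-injective eq
... | refl , eq′ with ++-overlap w r w′ r′ eq′
... | inj₁ (d , p , q) = inj₁ (d , cong (x ∷_) p , q)
... | inj₂ (d , p , q) = inj₂ (d , cong (x ∷_) p , q)

concatMap≡[]⇒≡[] : (f : A → List B) {d : List A} → All (λ a → NonEmpty (f a)) d → concatMap f d ≡ [] → d ≡ []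
concatMap≡[]⇒≡[] f []                       _  = refl
concatMap≡[]⇒≡[] f {a ∷ _} ((_ , _ , fa≡) ∷ _) eq with () ← trans (sym fa≡) (++-conicalˡ (f a) _ eq)

prefix-by-concatMap : (f : A → List B) (h c a b : List A) {e : List B} → h ++ c ≡ a ++ b →
  All (λ x → NonEmpty (f x)) (a ++ b) → concatMap f a ≡ concatMap f h ++ e →
  ∃ λ d → a ≡ h ++ d × c ≡ d ++ b × concatMap f d ≡ e
prefix-by-concatMap f h c a b {e} eq ne ea with ++-overlap h c a b eq
... | inj₁ (d , refl , c≡) = d , refl , c≡ , ++-cancelˡ (concatMap f h) _ _ (trans (sym (concatMap-++ f h d)) ea)
... | inj₂ (d , refl , refl) = [] , sym (trans (++-identityʳ (a ++ d)) a++d≡a) , sym (cong (_++ c) d≡[]) , sym e≡[]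
  where
  leftover : concatMap f d ++ e ≡ []
  leftover = ++-identityʳ-unique (concatMap f a) (begin
    concatMap f a                                ≡⟨ ea ⟩
    concatMap f (a ++ d) ++ e                    ≡⟨ cong (_++ e) (concatMap-++ f a d) ⟩
    (concatMap f a ++ concatMap f d) ++ e        ≡⟨ ++-assoc (concatMap f a) (concatMap f d) e ⟩
    concatMap f a ++ (concatMap f d ++ e)        ∎)
    where open ≡-Reasoning
  d≡[] : d ≡ []
  d≡[] = concatMap≡[]⇒≡[] f (++⁻ˡ d (++⁻ʳ a ne)) (++-conicalˡ (concatMap f d) e leftover)
  e≡[] : e ≡ []
  e≡[] = ++-conicalʳ (concatMap f d) e leftover
  a++d≡a : a ++ d ≡ a
  a++d≡a = trans (cong (a ++_) d≡[]) (++-identityʳ a)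

++-injective-concatMap : (f : A → List B) (a b a′ b′ : List A) → a ++ b ≡ a′ ++ b′ →
  concatMap f a ≡ concatMap f a′ → All (λ x → NonEmpty (f x)) (a ++ b) → a ≡ a′ × b ≡ b′
++-injective-concatMap f a b a′ b′ eq ea ne
  with prefix-by-concatMap f a′ b′ a b (sym eq) ne (trans ea (sym (++-identityʳ (concatMap f a′))))
... | d , refl , b′≡ , ed with concatMap≡[]⇒≡[] f (++⁻ʳ a′ (++⁻ˡ (a′ ++ d) ne)) ed
... | refl = ++-identityʳ a′ , sym b′≡

Part : Set → Set → Set
Part A C = List (List A × C)

elements : Part A C → List A
elements β = concat (map proj₁ β)

colours : Part A C → List C
colours = map proj₂

NonEmptyBlocks : Part A C → Set
NonEmptyBlocks = All (λ b → NonEmpty (proj₁ b))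

elements-++ : (α β : Part A C) → elements (α ++ β) ≡ elements α ++ elements β
elements-++ α β = concatMap-++ proj₁ α β

-- Coarsening by merging runs of consecutive blocks

Merges : Part A C → List A × C → Set
Merges g b = NonEmpty g × elements g ≡ proj₁ b × (∀ x → g ≡ x ∷ [] → proj₂ b ≡ proj₂ x)

-- For partitions of the same word this is _⪯_ (see ⊑⇒⪯ and ⪯⇒⊑).
infix 4 _⊑_

_⊑_ : Part A C → Part A C → Set
α ⊑ β = ∃ λ gs → concat gs ≡ α × Pointwise Merges gs β

⊑-[] : _⊑_ {A = A} {C = C} [] []
⊑-[] = [] , refl , []

⊑-++ : {α β α′ β′ : Part A C} → α ⊑ β → α′ ⊑ β′ → α ++ α′ ⊑ β ++ β′
⊑-++ (gs , refl , ms) (hs , refl , ns) = gs ++ hs , sym (concat-++ gs hs) , Pointwise.++⁺ ms ns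

Merges⇒⊑ : {g : Part A C} {b : List A × C} → Merges g b → g ⊑ [ b ]
Merges⇒⊑ {g = g} m = [ g ] , ++-identityʳ g , m ∷ []

⊑-elements : {α β : Part A C} → α ⊑ β → elements α ≡ elements β
⊑-elements (gs , refl , ms) = go ms
  where
  go : ∀ {gs β} → Pointwise Merges gs β → elements (concat gs) ≡ elements β
  go [] = refl
  go {g ∷ gs} ((_ , eq , _) ∷ ms) = trans (elements-++ g (concat gs)) (cong₂ _++_ eq (go ms))

⊑-nonEmptyBlocks : {α β : Part A C} → α ⊑ β → NonEmptyBlocks α → NonEmptyBlocks β
⊑-nonEmptyBlocks (gs , refl , ms) = go ms
  where
  merged : ∀ {g : Part A C} {b} → NonEmptyBlocks g → Merges g b → NonEmpty (proj₁ b)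
  merged ((x , xs , refl) ∷ _) ((_ , _ , refl) , refl , _) = x , _ , refl
  go : ∀ {gs β} → Pointwise Merges gs β → NonEmptyBlocks (concat gs) → NonEmptyBlocks β
  go [] _ = []
  go {g ∷ gs} (m ∷ ms) ne = merged (++⁻ˡ g ne) m ∷ go ms (++⁻ʳ g ne)

concat-tabulate-injective : {n : ℕ} (f g : Fin n → Part A C) → concat (tabulate f) ≡ concat (tabulate g) →
  (∀ k → elements (f k) ≡ elements (g k)) → NonEmptyBlocks (concat (tabulate f)) → ∀ k → f k ≡ g k
concat-tabulate-injective {n = suc n} f g eq ek ne k
  with ++-injective-concatMap proj₁ (f F.zero) _ (g F.zero) _ eq (ek F.zero) ne
concat-tabulate-injective f g eq ek ne F.zero    | f0≡g0 , _ = f0≡g0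
concat-tabulate-injective f g eq ek ne (F.suc k) | _ , rest≡ =
  concat-tabulate-injective (λ i → f (F.suc i)) (λ i → g (F.suc i)) rest≡ (λ i → ek (F.suc i)) (++⁻ʳ (f F.zero) ne) k

⊑-split : (a b a′ b′ : Part A C) → a ++ b ⊑ a′ ++ b′ → elements a ≡ elements a′ → NonEmptyBlocks (a ++ b) →
  a ⊑ a′ × b ⊑ b′
⊑-split a b [] b′ (hs , eq , ms) ea ne with concatMap≡[]⇒≡[] proj₁ (++⁻ˡ a ne) ea
... | refl = ⊑-[] , hs , eq , ms
⊑-split a b (y ∷ a″) b′ (h ∷ hs , eq , m@(_ , eh , _) ∷ ms) ea ne
  with prefix-by-concatMap proj₁ h (concat hs) a b eq ne (trans ea (cong (_++ elements a″) (sym eh)))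
... | d , refl , hs≡ , ed with ⊑-split d b a″ b′ (hs , hs≡ , ms) ed (++⁻ʳ h (subst NonEmptyBlocks (++-assoc h d b) ne))
... | (gs , refl , ns) , b⊑b′ = (h ∷ gs , refl , m ∷ ns) , b⊑b′

⊑-concat⁻ : {n : ℕ} (f g : Fin n → Part A C) → concat (tabulate f) ⊑ concat (tabulate g) →
  (∀ k → elements (f k) ≡ elements (g k)) → NonEmptyBlocks (concat (tabulate f)) → ∀ k → f k ⊑ g k
⊑-concat⁻ {n = suc n} f g r ek ne k with ⊑-split (f F.zero) _ (g F.zero) _ r (ek F.zero) ne
⊑-concat⁻ f g r ek ne F.zero    | r₀ , _ = r₀
⊑-concat⁻ f g r ek ne (F.suc k) | _ , r′ =
  ⊑-concat⁻ (λ i → f (F.suc i)) (λ i → g (F.suc i)) r′ (λ i → ek (F.suc i)) (++⁻ʳ (f F.zero) ne) k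

⊑-concat⁺ : {n : ℕ} (f g : Fin n → Part A C) → (∀ k → f k ⊑ g k) → concat (tabulate f) ⊑ concat (tabulate g)
⊑-concat⁺ {n = zero}  f g r = ⊑-[]
⊑-concat⁺ {n = suc n} f g r = ⊑-++ (r F.zero) (⊑-concat⁺ (λ i → f (F.suc i)) (λ i → g (F.suc i)) (λ i → r (F.suc i)))

piece : {gs : List (Part A C)} {β : Part A C} → Pointwise Merges gs β → Fin (length β) → Part A C
piece (_∷_ {x = g} _ _) F.zero    = g
piece (_ ∷ ms)          (F.suc k) = piece ms k

-- The runs of blocks of α merged into the successive blocks of β.
pieces : {α β : Part A C} → α ⊑ β → Fin (length β) → Part A C
pieces (_ , _ , ms) = piece ms

concat-pieces : {α β : Part A C} (r : α ⊑ β) → α ≡ concat (tabulate (pieces r))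
concat-pieces (gs , refl , ms) = go ms
  where
  go : ∀ {gs β} (ms : Pointwise Merges gs β) → concat gs ≡ concat (tabulate (piece ms))
  go [] = refl
  go (_∷_ {x = g} _ ms) = cong (g ++_) (go ms)

pieces-Merges : {α β : Part A C} (r : α ⊑ β) (k : Fin (length β)) → Merges (pieces r k) (lookup β k)
pieces-Merges (_ , _ , ms) = go ms
  where
  go : ∀ {gs β} (ms : Pointwise Merges gs β) (k : Fin (length β)) → Merges (piece ms k) (lookup β k)
  go (m ∷ _)  F.zero    = m
  go (_ ∷ ms) (F.suc k) = go ms k

pieces-nonEmptyBlocks : {α β : Part A C} (r : α ⊑ β) → NonEmptyBlocks α → ∀ k → NonEmptyBlocks (pieces r k)
pieces-nonEmptyBlocks r ne = tabulate⁻ (concat⁻ (subst NonEmptyBlocks (concat-pieces r) ne))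

pieces-elements : {α β : Part A C} (r : α ⊑ β) (k : Fin (length β)) → elements (pieces r k) ≡ proj₁ (lookup β k)
pieces-elements r k = proj₁ (proj₂ (pieces-Merges r k))

pieces-⊑ : {α β π : Part A C} (α⊑π : α ⊑ π) (β⊑π : β ⊑ π) → α ⊑ β → NonEmptyBlocks α → ∀ k → pieces α⊑π k ⊑ pieces β⊑π k
pieces-⊑ α⊑π β⊑π α⊑β ne = ⊑-concat⁻ _ _ (subst₂ _⊑_ (concat-pieces α⊑π) (concat-pieces β⊑π) α⊑β)
  (λ k → trans (pieces-elements α⊑π k) (sym (pieces-elements β⊑π k)))
  (subst NonEmptyBlocks (concat-pieces α⊑π) ne)

pieces-unique : {π : Part A C} {f : Fin (length π) → Part A C} (r : concat (tabulate f) ⊑ π) →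
  (∀ k → elements (f k) ≡ proj₁ (lookup π k)) → NonEmptyBlocks (concat (tabulate f)) → ∀ k → pieces r k ≡ f k
pieces-unique r ef ne = concat-tabulate-injective _ _ (sym (concat-pieces r))
  (λ k → trans (pieces-elements r k) (sym (ef k))) (subst NonEmptyBlocks (concat-pieces r) ne)

concat-tabulate-[lookup] : (β : List A) → concat (tabulate ([_] ∘ lookup β)) ≡ β
concat-tabulate-[lookup] β = begin
  concat (tabulate ([_] ∘ lookup β))       ≡⟨ cong concat (map-tabulate (lookup β) [_]) ⟨
  concat (map [_] (tabulate (lookup β)))   ≡⟨ concat-map-[ tabulate (lookup β) ] ⟩
  tabulate (lookup β)                      ≡⟨ tabulate-lookup β ⟩
  β                                        ∎
  where open ≡-Reasoning

colours-concat : {n : ℕ} (f : Fin n → Part A C) → colours (concat (tabulate f)) ≡ concat (tabulate (colours ∘ f))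
colours-concat f = trans (sym (concat-map (tabulate f))) (cong concat (map-tabulate f colours))

-- Substituting words for elements

module _ (f : A → List B) where

  relabel : List A × C → List B × C
  relabel b = concatMap f (proj₁ b) , proj₂ b

  expand : Part A C → Part B C
  expand = map relabel

  elements-expand : (X : Part A C) → elements (expand X) ≡ concatMap f (elements X)
  elements-expand []      = refl
  elements-expand (b ∷ X) = trans (cong (concatMap f (proj₁ b) ++_) (elements-expand X))
                                  (sym (concatMap-++ f (proj₁ b) (elements X)))

  colours-expand : (X : Part A C) → colours (expand X) ≡ colours X
  colours-expand X = sym (map-∘ X)

  expand-≡[_] : {g : Part A C} {z : List B × C} → expand g ≡ [ z ] → ∃ λ y → g ≡ [ y ] × relabel y ≡ z
  expand-≡[_] {g = y ∷ []} refl = y , refl , refl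

  expand-++⁻ : (X : Part A C) {h r : Part B C} → expand X ≡ h ++ r →
    ∃ λ X₁ → ∃ λ X₂ → X ≡ X₁ ++ X₂ × expand X₁ ≡ h × expand X₂ ≡ r
  expand-++⁻ X       {[]}    eq = [] , X , refl , refl , eq
  expand-++⁻ (x ∷ X) {y ∷ h} eq with ∷-injective eq
  ... | refl , eq′ with expand-++⁻ X {h} eq′
  ... | X₁ , X₂ , refl , refl , refl = x ∷ X₁ , X₂ , refl , refl , refl

  expand-Merges : {g : Part A C} {b : List A × C} → Merges g b → Merges (expand g) (relabel b)
  expand-Merges {g = g} ((x , xs , refl) , refl , keep) = (relabel x , expand xs , refl) , elements-expand g , keep′
    where
    keep′ : ∀ z → expand g ≡ [ z ] → proj₂ (relabel (elements g , _)) ≡ proj₂ z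
    keep′ z eq with expand-≡[ eq ]
    ... | y , g≡ , refl = keep y g≡

  expand-Merges⁻ : (g : Part A C) {b : List B × C} → Merges (expand g) b →
    Merges g (elements g , proj₂ b) × relabel (elements g , proj₂ b) ≡ b
  expand-Merges⁻ g@(x ∷ xs) (_ , eq , keep) =
    ((x , xs , refl) , refl , λ y g≡ → keep (relabel y) (cong expand g≡)) ,
    cong (_, _) (trans (sym (elements-expand g)) eq)

  expand-⊑ : {X Y : Part A C} → X ⊑ Y → expand X ⊑ expand Y
  expand-⊑ (gs , refl , ms) = map expand gs , concat-map gs , Pointwise.map⁺ expand relabel (Pointwise.map expand-Merges ms)

  expand-⊑⁻ : {X : Part A C} {W : Part B C} → expand X ⊑ W → ∃ λ Y → X ⊑ Y × expand Y ≡ W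
  expand-⊑⁻ {X = X} (_ , eq , ms) = go X eq ms
    where
    go : ∀ X {hs W} → concat hs ≡ expand X → Pointwise Merges hs W → ∃ λ Y → X ⊑ Y × expand Y ≡ W
    go []  refl [] = [] , ⊑-[] , refl
    go X {h ∷ hs} eq (m ∷ ms) with expand-++⁻ X {h} (sym eq)
    ... | X₁ , X₂ , refl , refl , eq₂ with go X₂ (sym eq₂) ms | expand-Merges⁻ X₁ m
    ... | Y₂ , X₂⊑Y₂ , refl | m₁ , refl = (elements X₁ , _) ∷ Y₂ , ⊑-++ (Merges⇒⊑ m₁) X₂⊑Y₂ , refl

  expand-injective : {Y Y′ : Part A C} → All (λ a → NonEmpty (f a)) (elements Y) →
    elements Y ≡ elements Y′ → expand Y ≡ expand Y′ → Y ≡ Y′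
  expand-injective {Y = []}          {[]}                _  _  _  = refl
  expand-injective {Y = (u , _) ∷ Y} {(u′ , _) ∷ Y′} ne eu eq with ∷-injective eq
  ... | head≡ , tail≡
    with ++-injective-concatMap f u (elements Y) u′ (elements Y′) eu (cong proj₁ head≡) ne | cong proj₂ head≡
  ... | refl , eY | refl = cong (_ ∷_) (expand-injective (++⁻ʳ u ne) eY tail≡)

  expand-⊑-reflects : {Y Y′ : Part A C} → All (λ a → NonEmpty (f a)) (elements Y) →
    elements Y ≡ elements Y′ → expand Y ⊑ expand Y′ → Y ⊑ Y′
  expand-⊑-reflects ne eY r with expand-⊑⁻ r
  ... | Y″ , Y⊑Y″ , eq = subst (_ ⊑_) Y″≡Y′ Y⊑Y″
    where
    Y″≡Y′ = expand-injective (subst (All _) (⊑-elements Y⊑Y″) ne) (trans (sym (⊑-elements Y⊑Y″)) eY) eq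

-- Through X, coarsenings of expand f X correspond to coarsenings of expand g X.
transport : (f : A → List B) (g : A → List B′) (X : Part A C) {W : Part B C} → expand f X ⊑ W → Part B′ C
transport f g X r = expand g (proj₁ (expand-⊑⁻ f r))

module _ (f : A → List B) (g : A → List B′) (X : Part A C) where

  transport-lower : {W : Part B C} (r : expand f X ⊑ W) → expand g X ⊑ transport f g X r
  transport-lower r = expand-⊑ g (proj₁ (proj₂ (expand-⊑⁻ f r)))

  colours-transport : {W : Part B C} (r : expand f X ⊑ W) → colours (transport f g X r) ≡ colours W
  colours-transport r with expand-⊑⁻ f r
  ... | Y , _ , refl = trans (colours-expand g Y) (sym (colours-expand f Y))

  module _ (nonempty : All (λ a → NonEmpty (f a)) (elements X)) where

    transport-unique : {W : Part B C} {Y : Part A C} (r : expand f X ⊑ W) → X ⊑ Y → expand f Y ≡ W →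
      transport f g X r ≡ expand g Y
    transport-unique r X⊑Y eq with expand-⊑⁻ f r
    ... | Y′ , X⊑Y′ , eq′ = cong (expand g) (expand-injective f (subst (All _) (⊑-elements X⊑Y′) nonempty)
                                   (trans (sym (⊑-elements X⊑Y′)) (⊑-elements X⊑Y)) (trans eq′ (sym eq)))

    transport-mono : {W W′ : Part B C} (r : expand f X ⊑ W) (r′ : expand f X ⊑ W′) → W ⊑ W′ →
      transport f g X r ⊑ transport f g X r′
    transport-mono r r′ W⊑W′ with expand-⊑⁻ f r | expand-⊑⁻ f r′
    ... | Y , X⊑Y , refl | Y′ , X⊑Y′ , refl =
      expand-⊑ g (expand-⊑-reflects f (subst (All _) (⊑-elements X⊑Y) nonempty)
                                       (trans (sym (⊑-elements X⊑Y)) (⊑-elements X⊑Y′)) W⊑W′)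

transport-transport : (f : A → List B) (g : A → List B′) (X : Part A C) → All (λ a → NonEmpty (g a)) (elements X) →
  {W : Part B C} (r : expand f X ⊑ W) (r′ : expand g X ⊑ transport f g X r) → transport g f X r′ ≡ W
transport-transport f g X nonempty r r′ with expand-⊑⁻ f r
... | Y , X⊑Y , refl = transport-unique g f X nonempty r′ X⊑Y refl

atoms : Part A C → Part (List A × C) C
atoms = map (λ b → [ b ] , proj₂ b)

colour : List A × C → List C
colour b = [ proj₂ b ]

elements-atoms : (α : Part A C) → elements (atoms α) ≡ α
elements-atoms α = trans (cong concat (sym (map-∘ α))) concat-map-[ α ]

expand-proj₁-atoms : (α : Part A C) → expand proj₁ (atoms α) ≡ α
expand-proj₁-atoms []      = refl
expand-proj₁-atoms (b ∷ α) = cong₂ _∷_ (cong (_, proj₂ b) (++-identityʳ (proj₁ b))) (expand-proj₁-atoms α)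

expand-colour-atoms : (α : Part A C) → expand colour (atoms α) ≡ 𝟎 (colours α)
expand-colour-atoms α = trans (sym (map-∘ α)) (map-∘ α)

concatMap-colour : (α : Part A C) → concatMap colour α ≡ colours α
concatMap-colour α = trans (cong concat (map-∘ α)) concat-map-[ colours α ]

Merges-atoms : {α : Part A C} {u : List A} {j : C} → Merges α (u , j) → Merges (atoms α) (α , j)
Merges-atoms {α = b ∷ []}     (_ , _ , keep) = (_ , _ , refl) , elements-atoms [ b ] , λ { _ refl → keep b refl }
Merges-atoms {α = b ∷ _ ∷ _} _              = (_ , _ , refl) , elements-atoms (b ∷ _) , λ _ ()

-- Collapsing every block of α to a point of its colour identifies the coarsenings of α below the block
-- (u , j) with the coarsenings of 𝟎 (colours α) below the block (colours α , j).
module Recolouring {α : Part A C} {u : List A} {j : C} (ne : NonEmptyBlocks α) (m : Merges α (u , j)) where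

  private
    nonempty-proj₁ : All (λ b → NonEmpty (proj₁ b)) (elements (atoms α))
    nonempty-proj₁ = subst NonEmptyBlocks (sym (elements-atoms α)) ne

    nonempty-colour : All (λ b → NonEmpty (colour b)) (elements (atoms α))
    nonempty-colour = All.universal (λ _ → _ , [] , refl) _

    atoms⊑top : atoms α ⊑ [ (α , j) ]
    atoms⊑top = Merges⇒⊑ (Merges-atoms m)

    α⊑top : α ⊑ [ (u , j) ]
    α⊑top = Merges⇒⊑ m

    from-α : {β : Part A C} → α ⊑ β → expand proj₁ (atoms α) ⊑ β
    from-α {β} = subst (_⊑ β) (sym (expand-proj₁-atoms α))

    from-𝟎 : {μ : Part C C} → 𝟎 (colours α) ⊑ μ → expand colour (atoms α) ⊑ μ
    from-𝟎 {μ} = subst (_⊑ μ) (sym (expand-colour-atoms α))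

  collapse : {β : Part A C} → α ⊑ β → Part C C
  collapse r = transport proj₁ colour (atoms α) (from-α r)

  collapse⁻¹ : {μ : Part C C} → 𝟎 (colours α) ⊑ μ → Part A C
  collapse⁻¹ s = transport colour proj₁ (atoms α) (from-𝟎 s)

  collapse-lower : {β : Part A C} (r : α ⊑ β) → 𝟎 (colours α) ⊑ collapse r
  collapse-lower r = subst (_⊑ collapse r) (expand-colour-atoms α) (transport-lower proj₁ colour (atoms α) (from-α r))

  collapse⁻¹-lower : {μ : Part C C} (s : 𝟎 (colours α) ⊑ μ) → α ⊑ collapse⁻¹ s
  collapse⁻¹-lower s = subst (_⊑ collapse⁻¹ s) (expand-proj₁-atoms α) (transport-lower colour proj₁ (atoms α) (from-𝟎 s))

  collapse-mono : {β β′ : Part A C} (r : α ⊑ β) (r′ : α ⊑ β′) → β ⊑ β′ → collapse r ⊑ collapse r′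
  collapse-mono r r′ = transport-mono proj₁ colour (atoms α) nonempty-proj₁ (from-α r) (from-α r′)

  collapse⁻¹-mono : {μ μ′ : Part C C} (s : 𝟎 (colours α) ⊑ μ) (s′ : 𝟎 (colours α) ⊑ μ′) → μ ⊑ μ′ →
    collapse⁻¹ s ⊑ collapse⁻¹ s′
  collapse⁻¹-mono s s′ = transport-mono colour proj₁ (atoms α) nonempty-colour (from-𝟎 s) (from-𝟎 s′)

  collapse⁻¹-collapse : {β : Part A C} {μ : Part C C} (r : α ⊑ β) (s : 𝟎 (colours α) ⊑ μ) → μ ≡ collapse r → collapse⁻¹ s ≡ β
  collapse⁻¹-collapse r s refl = transport-transport proj₁ colour (atoms α) nonempty-colour (from-α r) (from-𝟎 s)

  collapse-collapse⁻¹ : {β : Part A C} {μ : Part C C} (s : 𝟎 (colours α) ⊑ μ) (r : α ⊑ β) → β ≡ collapse⁻¹ s → collapse r ≡ μ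
  collapse-collapse⁻¹ s r refl = transport-transport colour proj₁ (atoms α) nonempty-proj₁ (from-𝟎 s) (from-α r)

  collapse-reflects : {β β′ : Part A C} (r : α ⊑ β) (r′ : α ⊑ β′) → collapse r ⊑ collapse r′ → β ⊑ β′
  collapse-reflects r r′ h = subst₂ _⊑_ (collapse⁻¹-collapse r _ refl) (collapse⁻¹-collapse r′ _ refl)
                                        (collapse⁻¹-mono (collapse-lower r) (collapse-lower r′) h)

  collapse-top : collapse α⊑top ≡ [ (colours α , j) ]
  collapse-top = trans (transport-unique proj₁ colour (atoms α) nonempty-proj₁ (from-α α⊑top) atoms⊑top
                                         (cong (λ v → [ (v , j) ]) (proj₁ (proj₂ m))))
                       (cong (λ v → [ (v , j) ]) (concatMap-colour α))

  collapse-upper : {β : Part A C} (r : α ⊑ β) → β ⊑ [ (u , j) ] → collapse r ⊑ [ (colours α , j) ]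
  collapse-upper r β⊑top = subst (collapse r ⊑_) collapse-top (collapse-mono r α⊑top β⊑top)

  collapse⁻¹-upper : {μ : Part C C} (s : 𝟎 (colours α) ⊑ μ) → μ ⊑ [ (colours α , j) ] → collapse⁻¹ s ⊑ [ (u , j) ]
  collapse⁻¹-upper s μ⊑top = subst (collapse⁻¹ s ⊑_) (collapse⁻¹-collapse α⊑top 𝟎⊑top (sym collapse-top))
                                   (collapse⁻¹-mono s 𝟎⊑top μ⊑top)
    where
    𝟎⊑top : 𝟎 (colours α) ⊑ [ (colours α , j) ]
    𝟎⊑top = subst (_ ⊑_) collapse-top (collapse-lower α⊑top)

  colours-collapse : {β : Part A C} (r : α ⊑ β) → colours (collapse r) ≡ colours β
  colours-collapse r = colours-transport proj₁ colour (atoms α) (from-α r)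

-- Positions of blocks

module _ {Γ : Set} where

  size : CPart Γ → ℕ
  size α = length (elements α)

  +-size-∷ : ∀ o (w : List Γ) c (α : CPart Γ) → (o + length w) + size α ≡ o + size ((w , c) ∷ α)
  +-size-∷ o w c α = trans (+-assoc o (length w) (size α)) (cong (o +_) (sym (length-++ w)))

  size-positive : {g : CPart Γ} → NonEmptyBlocks g → NonEmpty g → 0 < size g
  size-positive ((_ , _ , refl) ∷ _) _ = s≤s z≤n

  positioned-++ : ∀ o (α β : CPart Γ) → positioned o (α ++ β) ≡ positioned o α ++ positioned (o + size α) β
  positioned-++ o []            β = cong (λ o′ → positioned o′ β) (sym (+-identityʳ o))
  positioned-++ o ((w , c) ∷ α) β = cong (pb o (length w) c ∷_)
    (trans (positioned-++ (o + length w) α β)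
           (cong (λ o′ → positioned (o + length w) α ++ positioned o′ β) (+-size-∷ o w c α)))

  ∈-positioned-++⁻ : ∀ {o B} (α β : CPart Γ) → B ∈ positioned o (α ++ β) → B ∈ positioned o α ⊎ B ∈ positioned (o + size α) β
  ∈-positioned-++⁻ {o} α β B∈ = ∈-++⁻ (positioned o α) (subst (_ ∈_) (positioned-++ o α β) B∈)

  ∈-positioned-++⁺ʳ : ∀ {o B} (α β : CPart Γ) → B ∈ positioned (o + size α) β → B ∈ positioned o (α ++ β)
  ∈-positioned-++⁺ʳ {o} α β B∈ = subst (_ ∈_) (sym (positioned-++ o α β)) (∈-++⁺ʳ (positioned o α) B∈)

  start-lower : ∀ {o B} (α : CPart Γ) → B ∈ positioned o α → o ≤ start B
  start-lower          (_ ∷ α) (here refl) = ≤-refl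
  start-lower {o} ((w , _) ∷ α) (there B∈) = ≤-trans (m≤m+n o (length w)) (start-lower α B∈)

  end-upper : ∀ {o B} (α : CPart Γ) → B ∈ positioned o α → start B + len B ≤ o + size α
  end-upper {o} ((w , c) ∷ α) (here refl) =
    +-monoʳ-≤ o (≤-trans (m≤m+n (length w) (size α)) (≤-reflexive (sym (length-++ w))))
  end-upper {o} ((w , c) ∷ α) (there B∈) = ≤-trans (end-upper α B∈) (≤-reflexive (+-size-∷ o w c α))

  len-positive : ∀ {o B} {α : CPart Γ} → NonEmptyBlocks α → B ∈ positioned o α → 0 < len B
  len-positive ((_ , _ , refl) ∷ _) (here refl) = s≤s z≤n
  len-positive (_ ∷ ne)             (there B∈)  = len-positive ne B∈

  start-positionedAt : ∀ o (π : CPart Γ) k → o ≤ start (positionedAt o π k)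
  start-positionedAt o (_ ∷ π)       F.zero    = ≤-refl
  start-positionedAt o ((w , _) ∷ π) (F.suc k) = ≤-trans (m≤m+n o (length w)) (start-positionedAt (o + length w) π k)

  end≤⇒start< : ∀ {s l t} → 0 < l → s + l ≤ t → s < t
  end≤⇒start< {s} l>0 = <-≤-trans (m<m+n s l>0)

  length-positive : {w : List Γ} → NonEmpty w → 0 < length w
  length-positive (_ , _ , refl) = s≤s z≤n

  nonEmpty-elements : {g : CPart Γ} → NonEmpty (elements g) → NonEmpty g
  nonEmpty-elements {x ∷ g} _ = x , g , refl

  -- _⪯_ for the two partitions laid out from position o on; _⪯_ is the case o = 0.
  infix 4 _⪯⟨_⟩_
  _⪯⟨_⟩_ : CPart Γ → ℕ → CPart Γ → Set
  α ⪯⟨ o ⟩ β = (∀ B → B ∈ positioned o α → ∃ λ C → C ∈ positioned o β × B ⊆ᵇ C) ×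
               (∀ B C → B ∈ positioned o α → C ∈ positioned o β → start B ≡ start C → len B ≡ len C → col B ≡ col C)

  merged-colour : ∀ {o B c} (g : CPart Γ) → NonEmptyBlocks g → Merges g (elements g , c) →
    B ∈ positioned o g → start B ≡ o → len B ≡ size g → col B ≡ c
  merged-colour ((w , c₁) ∷ []) _ (_ , _ , keep) (here refl) _ _ = sym (keep (w , c₁) refl)
  merged-colour ((w , _) ∷ g′@(_ ∷ _)) (_ ∷ ne′) _ (here refl) _ len≡ =
    ⊥-elim (<-irrefl len≡ (<-≤-trans (m<m+n (length w) (size-positive ne′ (_ , _ , refl)))
                                     (≤-reflexive (sym (length-++ w)))))
  merged-colour {o} ((w , _) ∷ g′) (nw ∷ _) _ (there B∈) start≡ _ =
    ⊥-elim (<⇒≱ (m<m+n o (length-positive nw)) (≤-trans (start-lower g′ B∈) (≤-reflexive start≡)))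

  ⪯⟨⟩-merge : ∀ o {c} (g α β : CPart Γ) → NonEmptyBlocks g → Merges g (elements g , c) →
    α ⪯⟨ o + size g ⟩ β → g ++ α ⪯⟨ o ⟩ (elements g , c) ∷ β
  ⪯⟨⟩-merge o {c} g α β ne m@(nonempty , _ , _) (contained , same-colour) = contained′ , same-colour′
    where
    contained′ : ∀ B → B ∈ positioned o (g ++ α) → ∃ λ C → C ∈ positioned o ((elements g , c) ∷ β) × B ⊆ᵇ C
    contained′ B B∈ with ∈-positioned-++⁻ g α B∈
    ... | inj₁ B∈g = _ , here refl , start-lower g B∈g , end-upper g B∈g
    ... | inj₂ B∈α with contained B B∈α
    ...   | C , C∈ , B⊆C = C , there C∈ , B⊆C
    same-colour′ : ∀ B C → B ∈ positioned o (g ++ α) → C ∈ positioned o ((elements g , c) ∷ β) →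
      start B ≡ start C → len B ≡ len C → col B ≡ col C
    same-colour′ B C B∈ C∈ s≡ l≡ with ∈-positioned-++⁻ g α B∈ | C∈
    ... | inj₁ B∈g | here refl = merged-colour g ne m B∈g s≡ l≡
    ... | inj₂ B∈α | here refl =
      ⊥-elim (<⇒≱ (m<m+n o (size-positive ne nonempty)) (≤-trans (start-lower α B∈α) (≤-reflexive s≡)))
    ... | inj₁ B∈g | there C∈β =
      ⊥-elim (<⇒≱ (end≤⇒start< (len-positive ne B∈g) (end-upper g B∈g)) (≤-trans (start-lower β C∈β) (≤-reflexive (sym s≡))))
    ... | inj₂ B∈α | there C∈β = same-colour B C B∈α C∈β s≡ l≡

  ⪯⟨⟩-merge⁻ : ∀ o {c} (g α β : CPart Γ) → NonEmptyBlocks (g ++ α) → NonEmpty (elements g) →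
    g ++ α ⪯⟨ o ⟩ (elements g , c) ∷ β → Merges g (elements g , c) × α ⪯⟨ o + size g ⟩ β
  ⪯⟨⟩-merge⁻ o {c} g α β ne ne-g (contained , same-colour) =
    (nonEmpty-elements ne-g , refl , keep) , contained′ , λ B C B∈ C∈ → same-colour B C (∈-positioned-++⁺ʳ g α B∈) (there C∈)
    where
    keep : ∀ x → g ≡ [ x ] → c ≡ proj₂ x
    keep x g≡ = sym (same-colour _ _ (subst (λ g → _ ∈ positioned o (g ++ α)) (sym g≡) (here refl)) (here refl) refl
                       (cong length (sym (trans (cong elements g≡) (++-identityʳ (proj₁ x))))))
    contained′ : ∀ B → B ∈ positioned (o + size g) α → ∃ λ C → C ∈ positioned (o + size g) β × B ⊆ᵇ C
    contained′ B B∈ with contained B (∈-positioned-++⁺ʳ g α B∈)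
    ... | C , here refl , _ , end≤ =
      ⊥-elim (<⇒≱ (end≤⇒start< (len-positive (++⁻ʳ g ne) B∈) end≤) (start-lower α B∈))
    ... | C , there C∈ , B⊆C = C , C∈ , B⊆C

  ⊑⇒⪯⟨⟩ : ∀ o {α β : CPart Γ} → α ⊑ β → NonEmptyBlocks α → α ⪯⟨ o ⟩ β
  ⊑⇒⪯⟨⟩ o (gs , refl , ms) = go o ms
    where
    go : ∀ o {gs} {β : CPart Γ} → Pointwise Merges gs β → NonEmptyBlocks (concat gs) → concat gs ⪯⟨ o ⟩ β
    go o [] _ = (λ _ ()) , (λ _ _ ())
    go o {g ∷ gs} (m@(_ , refl , _) ∷ ms) ne = ⪯⟨⟩-merge o g (concat gs) _ (++⁻ˡ g ne) m (go (o + size g) ms (++⁻ʳ g ne))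

  split-at : ∀ o (α : CPart Γ) (u r : List Γ) → elements α ≡ u ++ r → NonEmptyBlocks α →
    (∀ B → B ∈ positioned o α → start B + len B ≤ o + length u ⊎ o + length u ≤ start B) →
    ∃₂ λ g α′ → α ≡ g ++ α′ × elements g ≡ u × elements α′ ≡ r
  split-at o α [] r eq _ _ = [] , α , refl , refl , eq
  split-at o ((w , c) ∷ α) u@(_ ∷ _) r eq (_ ∷ ne) apart with ++-overlap w (elements α) u r eq
  ... | inj₁ (d , u≡ , eα) with split-at (o + length w) α d r eα ne
          (λ B B∈ → subst (λ t → start B + len B ≤ t ⊎ t ≤ start B) offset≡ (apart B (there B∈)))
    where
    offset≡ : o + length u ≡ (o + length w) + length d
    offset≡ = trans (cong (λ v → o + length v) u≡)
                    (trans (cong (o +_) (length-++ w)) (sym (+-assoc o (length w) (length d))))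
  ...   | g , α′ , refl , eg , eα′ = (w , c) ∷ g , α′ , refl , trans (cong (w ++_) eg) (sym u≡) , eα′
  split-at o ((w , c) ∷ α) u@(_ ∷ _) r eq (_ ∷ ne) apart | inj₂ ([] , refl , refl) =
    [ (u ++ [] , c) ] , α , refl , trans (++-identityʳ _) (++-identityʳ u) , refl
  split-at o ((w , c) ∷ α) u@(_ ∷ _) r eq (_ ∷ ne) apart | inj₂ (_ ∷ _ , refl , refl) with apart _ (here refl)
  ... | inj₁ end≤ =
    ⊥-elim (m+1+n≰m (length u) (+-cancelˡ-≤ o _ _ (subst (_≤ o + length u) (cong (o +_) (length-++ u)) end≤)))
  ... | inj₂ u≤o  = ⊥-elim (m+1+n≰m o u≤o)

  apart-from-first : ∀ {o c} (u : List Γ) (β : CPart Γ) B → (∃ λ C → C ∈ positioned o ((u , c) ∷ β) × B ⊆ᵇ C) →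
    start B + len B ≤ o + length u ⊎ o + length u ≤ start B
  apart-from-first u β B (_ , here refl , _ , end≤)  = inj₁ end≤
  apart-from-first u β B (_ , there C∈ , start≥ , _) = inj₂ (≤-trans (start-lower β C∈) start≥)

  ⪯⟨⟩⇒⊑ : ∀ o (α β : CPart Γ) → α ⪯⟨ o ⟩ β → NonEmptyBlocks α → NonEmptyBlocks β → elements α ≡ elements β → α ⊑ β
  ⪯⟨⟩⇒⊑ o α [] _ neα _ eq = subst (_⊑ []) (sym (concatMap≡[]⇒≡[] proj₁ neα eq)) ⊑-[]
  ⪯⟨⟩⇒⊑ o α ((u , c) ∷ β) α⪯@(contained , _) neα (neu ∷ neβ) eq
    with split-at o α u (elements β) eq neα (λ B B∈ → apart-from-first u β B (contained B B∈))
  ... | g , α′ , refl , refl , eα′ with ⪯⟨⟩-merge⁻ o g α′ β neα neu α⪯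
  ... | m , α′⪯β = ⊑-++ (Merges⇒⊑ m) (⪯⟨⟩⇒⊑ (o + size g) α′ β α′⪯β (++⁻ʳ g neα) neβ eα′)

  ⪯⇒⊑ : {S : List Γ} {α β : CPart Γ} → IsPartOf S α → IsPartOf S β → α ⪯ β → α ⊑ β
  ⪯⇒⊑ pα pβ α⪯β = ⪯⟨⟩⇒⊑ 0 _ _ α⪯β (nonempty pα) (nonempty pβ) (trans (covers pα) (sym (covers pβ)))
    where open IsPartOf

  ⊑⇒⪯ : {α β : CPart Γ} → NonEmptyBlocks α → α ⊑ β → α ⪯ β
  ⊑⇒⪯ ne α⊑β = ⊑⇒⪯⟨⟩ 0 α⊑β ne

  elements≡[_]⁻ : {g : CPart Γ} {x : Γ} → NonEmptyBlocks g → elements g ≡ [ x ] → ∃ λ y → g ≡ [ y ] × proj₁ y ≡ [ x ]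
  elements≡[_]⁻ {(_ ∷ as , _) ∷ g′} ((_ , _ , refl) ∷ ne′) eq with ∷-injective eq
  ... | refl , rest≡[] with ++-conicalˡ as _ rest≡[] | concatMap≡[]⇒≡[] proj₁ ne′ (++-conicalʳ as _ rest≡[])
  ... | refl | refl = _ , refl , refl

  ⊑-singletons : {α β : CPart Γ} → α ⊑ β → NonEmptyBlocks α → All SingletonOK α → All SingletonOK β
  ⊑-singletons (gs , refl , ms) = go ms
    where
    merged : {g : CPart Γ} {c : Γ} → NonEmptyBlocks g → All SingletonOK g → Merges g (elements g , c) →
      SingletonOK (elements g , c)
    merged ne ok (_ , _ , keep) x eq with elements≡[ ne ]⁻ eq
    ... | y , refl , y≡ with ok
    ...   | ok-y ∷ [] = trans (keep y refl) (ok-y x y≡)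
    go : ∀ {gs} {β : CPart Γ} → Pointwise Merges gs β → NonEmptyBlocks (concat gs) → All SingletonOK (concat gs) →
      All SingletonOK β
    go [] _ _ = []
    go {g ∷ gs} (m@(_ , refl , _) ∷ ms) ne ok = merged (++⁻ˡ g ne) (++⁻ˡ g ok) m ∷ go ms (++⁻ʳ g ne) (++⁻ʳ g ok)

  ⊑-isPartOf : {S : List Γ} {α β : CPart Γ} → IsPartOf S α → α ⊑ β → IsPartOf S β
  ⊑-isPartOf pα α⊑β = record
    { covers    = trans (sym (⊑-elements α⊑β)) (covers pα)
    ; nonempty  = ⊑-nonEmptyBlocks α⊑β (nonempty pα)
    ; singleton = ⊑-singletons α⊑β (nonempty pα) (singleton pα)
    }
    where open IsPartOf

  segment : {S : List Γ} {σ ρ π : CPart Γ} → IsPartOf S σ → σ ⊑ ρ → ρ ⊑ π → Segment S σ π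
  segment pσ σ⊑ρ ρ⊑π = seg (_ , ⊑-isPartOf pσ σ⊑ρ) (⊑⇒⪯ (IsPartOf.nonempty pσ) σ⊑ρ)
                           (⊑⇒⪯ (⊑-nonEmptyBlocks σ⊑ρ (IsPartOf.nonempty pσ)) ρ⊑π)

  segment⁻ : {S : List Γ} {σ π : CPart Γ} → IsPartOf S σ → NonEmptyBlocks π → elements π ≡ S →
    (l : Segment S σ π) → σ ⊑ part l × part l ⊑ π
  segment⁻ pσ neπ eπ (seg (_ , pρ) σ⪯ρ ρ⪯π) =
    ⪯⇒⊑ pσ pρ σ⪯ρ , ⪯⟨⟩⇒⊑ 0 _ _ ρ⪯π (IsPartOf.nonempty pρ) neπ (trans (IsPartOf.covers pρ) (sym eπ))

  part-isPartOf : {S : List Γ} {σ π : CPart Γ} (l : Segment S σ π) → IsPartOf S (part l)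
  part-isPartOf l = proj₂ (Segment.elem l)

  disjoint-⊆ᵇ : {B C : PBlock Γ} → 0 < len B → start B + len B ≤ start C ⊎ start C + len C ≤ start B → ¬ B ⊆ᵇ C
  disjoint-⊆ᵇ l>0 (inj₁ B-before-C) (C≤B , _) = <⇒≱ (end≤⇒start< l>0 B-before-C) C≤B
  disjoint-⊆ᵇ l>0 (inj₂ C-before-B) (_ , end≤) = <⇒≱ (end≤⇒start< l>0 (≤-trans end≤ C-before-B)) ≤-refl

  col-positioned : ∀ o (α : CPart Γ) → map col (positioned o α) ≡ colours α
  col-positioned o []            = refl
  col-positioned o ((w , c) ∷ α) = cong (c ∷_) (col-positioned (o + length w) α)

  filter-⊆-first : ∀ o {c} (g α : CPart Γ) → NonEmptyBlocks α →
    filter (λ B → B ⊆ᵇ? pb o (size g) c) (positioned o (g ++ α)) ≡ positioned o g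
  filter-⊆-first o {c} g α ne = begin
    filter P? (positioned o (g ++ α))                                ≡⟨ cong (filter P?) (positioned-++ o g α) ⟩
    filter P? (positioned o g ++ positioned (o + size g) α)          ≡⟨ filter-++ P? (positioned o g) _ ⟩
    filter P? (positioned o g) ++ filter P? (positioned (o + size g) α)
      ≡⟨ cong₂ _++_ (filter-all P? (All.tabulate (λ B∈ → start-lower g B∈ , end-upper g B∈)))
                    (filter-none P? (All.tabulate (λ {B} B∈ → disjoint-⊆ᵇ {B = B} {C = pb o (size g) c}
                                                      (len-positive ne B∈) (inj₂ (start-lower α B∈))))) ⟩
    positioned o g ++ []                                             ≡⟨ ++-identityʳ _ ⟩
    positioned o g                                                   ∎
    where
    open ≡-Reasoning
    P? = λ B → B ⊆ᵇ? pb o (size g) c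

  filter-⊆-later : ∀ o (g α π : CPart Γ) k → NonEmptyBlocks g →
    filter (λ B → B ⊆ᵇ? positionedAt (o + size g) π k) (positioned o (g ++ α)) ≡
    filter (λ B → B ⊆ᵇ? positionedAt (o + size g) π k) (positioned (o + size g) α)
  filter-⊆-later o g α π k ne = begin
    filter P? (positioned o (g ++ α))                                ≡⟨ cong (filter P?) (positioned-++ o g α) ⟩
    filter P? (positioned o g ++ positioned (o + size g) α)          ≡⟨ filter-++ P? (positioned o g) _ ⟩
    filter P? (positioned o g) ++ filter P? (positioned (o + size g) α)
      ≡⟨ cong (_++ filter P? (positioned (o + size g) α))
              (filter-none P? (All.tabulate (λ {B} B∈ → disjoint-⊆ᵇ {B = B} {C = positionedAt (o + size g) π k}
                 (len-positive ne B∈) (inj₁ (≤-trans (end-upper g B∈) (start-positionedAt (o + size g) π k)))))) ⟩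
    filter P? (positioned (o + size g) α)                            ∎
    where
    open ≡-Reasoning
    P? = λ B → B ⊆ᵇ? positionedAt (o + size g) π k

  filter-positioned-piece : ∀ o {gs} {π : CPart Γ} (ms : Pointwise Merges gs π) → NonEmptyBlocks (concat gs) → ∀ k →
    map col (filter (λ B → B ⊆ᵇ? positionedAt o π k) (positioned o (concat gs))) ≡ colours (piece ms k)
  filter-positioned-piece o {g ∷ gs} {(_ , c) ∷ _} ((_ , refl , _) ∷ ms) ne F.zero =
    trans (cong (map col) (filter-⊆-first o {c} g (concat gs) (++⁻ʳ g ne))) (col-positioned o g)
  filter-positioned-piece o {g ∷ gs} {_ ∷ π} ((_ , refl , _) ∷ ms) ne (F.suc k) =
    trans (cong (map col) (filter-⊆-later o g (concat gs) π k (++⁻ˡ g ne)))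
          (filter-positioned-piece (o + size g) ms (++⁻ʳ g ne) k)

  subWord-pieces : {σ π : CPart Γ} (σ⊑π : σ ⊑ π) → NonEmptyBlocks σ → ∀ k → subWord σ π k ≡ colours (pieces σ⊑π k)
  subWord-pieces (_ , refl , ms) = filter-positioned-piece 0 ms

-- The segment [σ, π]

colours-nonEmpty : {α : Part A C} → NonEmpty α → NonEmpty (colours α)
colours-nonEmpty (b , α , refl) = proj₂ b , colours α , refl

isPartOf-𝟎 : {Γ : Set} (v : List Γ) → IsPartOf v (𝟎 v)
isPartOf-𝟎 v = record
  { covers    = trans (cong concat (sym (map-∘ v))) concat-map-[ v ]
  ; nonempty  = map⁺ (All.universal (λ x → x , [] , refl) v)
  ; singleton = map⁺ (All.universal (λ x _ eq → ∷-injectiveˡ eq) v)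
  }

module _ {Γ : Set} {v : List Γ} {j : Γ} where

  Y-intro : {μ : CPart Γ} → 𝟎 v ⊑ μ → μ ⊑ [ (v , j) ] → Y v j
  Y-intro = segment (isPartOf-𝟎 v)

  Y-elim : NonEmpty v → (t : Y v j) → 𝟎 v ⊑ part t × part t ⊑ [ (v , j) ]
  Y-elim nv = segment⁻ (isPartOf-𝟎 v) (nv ∷ []) (++-identityʳ v)

module Interval {Γ : Set} {S : List Γ} {σ π : CPart Γ} (pσ : IsPartOf S σ) (pπ : IsPartOf S π) (σ⪯π : σ ⪯ π) where

  open IsPartOf

  Index : Set
  Index = Fin (length π)

  Factor : Index → Set
  Factor k = Y (subWord σ π k) (colAt π k)

  σ⊑π : σ ⊑ π
  σ⊑π = ⪯⇒⊑ pσ pπ σ⪯π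

  σₖ : Index → CPart Γ
  σₖ = pieces σ⊑π

  module R (k : Index) = Recolouring (pieces-nonEmptyBlocks σ⊑π (nonempty pσ) k) (pieces-Merges σ⊑π k)

  colours-σₖ : ∀ k → colours (σₖ k) ≡ subWord σ π k
  colours-σₖ k = sym (subWord-pieces σ⊑π (nonempty pσ) k)

  factor : ∀ k {μ} → 𝟎 (colours (σₖ k)) ⊑ μ → μ ⊑ [ (colours (σₖ k) , colAt π k) ] → Factor k
  factor k lower upper = Y-intro (subst (λ v → 𝟎 v ⊑ _) (colours-σₖ k) lower)
                                 (subst (λ v → _ ⊑ [ (v , colAt π k) ]) (colours-σₖ k) upper)

  factor⁻ : ∀ k (t : Factor k) → 𝟎 (colours (σₖ k)) ⊑ part t × part t ⊑ [ (colours (σₖ k) , colAt π k) ]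
  factor⁻ k t = subst (λ v → 𝟎 v ⊑ part t × part t ⊑ [ (v , colAt π k) ]) (sym (colours-σₖ k))
                      (Y-elim (subst NonEmpty (colours-σₖ k) (colours-nonEmpty (proj₁ (pieces-Merges σ⊑π k)))) t)

  module Cut (l : Segment S σ π) where

    σ⊑ρ : σ ⊑ part l
    σ⊑ρ = proj₁ (segment⁻ pσ (nonempty pπ) (covers pπ) l)

    ρ⊑π : part l ⊑ π
    ρ⊑π = proj₂ (segment⁻ pσ (nonempty pπ) (covers pπ) l)

    ρₖ : Index → CPart Γ
    ρₖ = pieces ρ⊑π

    σₖ⊑ρₖ : ∀ k → σₖ k ⊑ ρₖ k
    σₖ⊑ρₖ = pieces-⊑ σ⊑π ρ⊑π σ⊑ρ (nonempty pσ)

  θ : Segment S σ π → (k : Index) → Factor k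
  θ l k = factor k (R.collapse-lower k (σₖ⊑ρₖ k)) (R.collapse-upper k (σₖ⊑ρₖ k) (Merges⇒⊑ (pieces-Merges ρ⊑π k)))
    where open Cut l

  module Glue (t : (k : Index) → Factor k) where

    ρₖ : Index → CPart Γ
    ρₖ k = R.collapse⁻¹ k (proj₁ (factor⁻ k (t k)))

    ρ : CPart Γ
    ρ = concat (tabulate ρₖ)

    ρₖ⊑top : ∀ k → ρₖ k ⊑ [ lookup π k ]
    ρₖ⊑top k = R.collapse⁻¹-upper k (proj₁ (factor⁻ k (t k))) (proj₂ (factor⁻ k (t k)))

    σ⊑ρ : σ ⊑ ρ
    σ⊑ρ = subst (_⊑ ρ) (sym (concat-pieces σ⊑π)) (⊑-concat⁺ σₖ ρₖ (λ k → R.collapse⁻¹-lower k (proj₁ (factor⁻ k (t k)))))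

    ρ⊑π : ρ ⊑ π
    ρ⊑π = subst (ρ ⊑_) (concat-tabulate-[lookup] π) (⊑-concat⁺ ρₖ _ ρₖ⊑top)

  ψ : ((k : Index) → Factor k) → Segment S σ π
  ψ t = segment pσ σ⊑ρ ρ⊑π
    where open Glue t

  ψ∘θ : ∀ l → part (ψ (θ l)) ≡ part l
  ψ∘θ l = trans (cong concat (tabulate-cong (λ k → R.collapse⁻¹-collapse k (σₖ⊑ρₖ k) _ refl))) (sym (concat-pieces ρ⊑π))
    where open Cut l

  θ∘ψ : ∀ t k → part (θ (ψ t) k) ≡ part (t k)
  θ∘ψ t k = R.collapse-collapse⁻¹ k (proj₁ (factor⁻ k (t k))) (Cut.σₖ⊑ρₖ (ψ t) k)
              (pieces-unique (Cut.ρ⊑π (ψ t)) (λ k → trans (⊑-elements (Glue.ρₖ⊑top t k)) (++-identityʳ _))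
                             (nonempty (part-isPartOf (ψ t))) k)

  θ-mono : ∀ l l′ → part l ⪯ part l′ → ∀ k → part (θ l k) ⪯ part (θ l′ k)
  θ-mono l l′ l⪯l′ k = ⊑⇒⪯ (nonempty (part-isPartOf (θ l k))) (R.collapse-mono k (Cut.σₖ⊑ρₖ l k) (Cut.σₖ⊑ρₖ l′ k)
    (pieces-⊑ (Cut.ρ⊑π l) (Cut.ρ⊑π l′) (⪯⇒⊑ (part-isPartOf l) (part-isPartOf l′) l⪯l′) (nonempty (part-isPartOf l)) k))

  θ-reflects : ∀ l l′ → (∀ k → part (θ l k) ⪯ part (θ l′ k)) → part l ⪯ part l′
  θ-reflects l l′ θl⪯θl′ = ⊑⇒⪯ (nonempty (part-isPartOf l))
    (subst₂ _⊑_ (sym (concat-pieces (Cut.ρ⊑π l))) (sym (concat-pieces (Cut.ρ⊑π l′)))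
                (⊑-concat⁺ (Cut.ρₖ l) (Cut.ρₖ l′) ρₖ⊑ρ′ₖ))
    where
    ρₖ⊑ρ′ₖ : ∀ k → Cut.ρₖ l k ⊑ Cut.ρₖ l′ k
    ρₖ⊑ρ′ₖ k = R.collapse-reflects k (Cut.σₖ⊑ρₖ l k) (Cut.σₖ⊑ρₖ l′ k)
                 (⪯⇒⊑ (part-isPartOf (θ l k)) (part-isPartOf (θ l′ k)) (θl⪯θl′ k))

  blockWord-θ : ∀ l → blockWord (part l) ≡ concat (tabulate (λ k → blockWord (part (θ l k))))
  blockWord-θ l = begin
    colours (part l)                                  ≡⟨ cong colours (concat-pieces ρ⊑π) ⟩
    colours (concat (tabulate ρₖ))                    ≡⟨ colours-concat ρₖ ⟩
    concat (tabulate (colours ∘ ρₖ))                  ≡⟨ cong concat (tabulate-cong (λ k → R.colours-collapse k (σₖ⊑ρₖ k))) ⟨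
    concat (tabulate (λ k → colours (part (θ l k))))  ∎
    where
    open Cut l
    open ≡-Reasoning

lemma1 : (m : ℕ) (S : List (Fin m)) (σ π : 𝒴 S) → proj₁ σ ⪯ proj₁ π →
    Σ (Segment S (proj₁ σ) (proj₁ π) → (k : Fin (length (proj₁ π))) → Y (subWord (proj₁ σ) (proj₁ π) k) (colAt (proj₁ π) k)) λ θ →
    Σ (((k : Fin (length (proj₁ π))) → Y (subWord (proj₁ σ) (proj₁ π) k) (colAt (proj₁ π) k)) → Segment S (proj₁ σ) (proj₁ π)) λ ψ →
      (∀ l → part (ψ (θ l)) ≡ part l) ×
      (∀ t → (k : Fin (length (proj₁ π))) → part (θ (ψ t) k) ≡ part (t k)) ×
      (∀ l l′ → part l ⪯ part l′ → ((k : Fin (length (proj₁ π))) → part (θ l k) ⪯ part (θ l′ k))) ×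
      (∀ l l′ → ((k : Fin (length (proj₁ π))) → part (θ l k) ⪯ part (θ l′ k)) → part l ⪯ part l′) ×
      (∀ l → blockWord (part l) ≡ concat (tabulate (λ k → blockWord (part (θ l k)))))
lemma1 m S (σ , pσ) (π , pπ) σ⪯π = θ , ψ , ψ∘θ , θ∘ψ , θ-mono , θ-reflects , blockWord-θ
  where open Interval pσ pπ σ⪯π
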